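{- Let $h$ be a symmetric super-additive functional and let $n,a,b,t$ be integers with $n\ge 1$, $t\ge 1$. Then $$\widehat{N}_h(n,a,b,t)\le N_h(n,a,b,t)\le n^2\cdot \widehat{N}_h(n,a,b,t).$$
   Context: Families are sets of subsets of $[n]=\{1,\dots,n\}$; a family is $m$-uniform if all its members have size $m$; families $\mathcal{F},\mathcal{G}$ are cross-$t$-intersecting if $|F\cap G|\ge t$ for all $F\in\mathcal{F},G\in\mathcal{G}$. A functional $h$ is a function assigning a real number to each pair $(\mathcal{F},\mathcal{G})$ of families. $h$ is symmetric if $h(\mathcal{F},\mathcal{G})=h(\mathcal{F}',\mathcal{G}')$ whenever $|\mathcal{F}'|=|\mathcal{F}|$ and $|\mathcal{G}'|=|\mathcal{G}|$. $h$ is super-additive if whenever families $\mathcal{F},\mathcal{G},\mathcal{F}_1,\mathcal{G}_1,\dots,\mathcal{F}_k,\mathcal{G}_k$ satisfy $\mathcal{F}\times\mathcal{G}\subseteq\bigcup_{i=1}^k\mathcal{F}_i\times\mathcal{G}_i$, we have $h(\mathcal{F},\mathcal{G})\le\sum_{i=1}^k h(\mathcal{F}_i,\mathcal{G}_i)$. $N_h(n,a,b,t)$ denotes the maximum of $h(\mathcal{F},\mathcal{G})$ over all pairs where $\mathcal{F}$ is $a$-uniform, $\mathcal{G}$ is $b$-uniform, and $\mathcal{F},\mathcal{G}$ are cross-$t$-intersecting. $\widehat{N}_h(n,a,b,t)$ denotes $$\max_{\substack{u,v,s\in[n]\\ u+v=s+t}} h\left(\left\{F\in\tbinom{[n]}{a}: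 |F\cap[s]|\ge u\right\},\left\{G\in\tbinom{[n]}{b}: |G\cap[s]|\ge v\right\}\right),$$ where $\binom{[n]}{m}$ is the set of all $m$-element subsets of $[n]$. -}

module Defs where

open import Level using (Level; suc; _⊔_)
open import Data.Bool using (Bool; true; false; if_then_else_; _∧_)
open import Data.Nat as ℕ using (ℕ; zero; _*_; _≡ᵇ_; _<ᵇ_; _≤ᵇ_)
open import Data.Fin using (Fin; toℕ)
open import Data.Fin.Subset using (Subset; _∩_; ∣_∣)
open import Data.Vec using (Vec; []; _∷_; tabulate)
open import Data.List using (List; []; _∷_; [_]; map; _++_; length)
open import Data.Nat.ListAction using (sum)
open import Data.Product using (Σ; _×_; _,_)
open import Data.Sum using (_⊎_)
open import Relation.Binary.PropositionalEquality using (_≡_)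
import Data.List.Relation.Unary.Any

-- The paper's functionals are real-valued; agda-stdlib has no reals, so
-- we allow values in an arbitrary totally preordered commutative monoid
-- with translation-invariant order (ℝ with + and ≤ is an instance).

record OrderedValues (c ℓ : Level) : Set (suc (c ⊔ ℓ)) where
  infixl 6 _+_
  infix  4 _≤_
  field
    Carrier   : Set c
    _≤_       : Carrier → Carrier → Set ℓ
    _+_       : Carrier → Carrier → Carrier
    0#        : Carrier
    ≤-refl    : ∀ {x} → x ≤ x
    ≤-trans   : ∀ {x y z} → x ≤ y → y ≤ z → x ≤ z
    ≤-total   : ∀ x y → (x ≤ y) ⊎ (y ≤ x)
    +-assoc   : ∀ x y z → (x + y) + z ≡ x + (y + z)
    +-comm    : ∀ x y → x + y ≡ y + x
    +-identityˡ : ∀ x → 0# + x ≡ x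
    +-monoˡ-≤ : ∀ {x y} z → x ≤ y → x + z ≤ y + z

  Σ[_] : List Carrier → Carrier
  Σ[ [] ]     = 0#
  Σ[ x ∷ xs ] = x + Σ[ xs ]

  infixl 7 _·_
  _·_ : ℕ → Carrier → Carrier
  zero    · x = 0#
  ℕ.suc k · x = x + k · x

-- Subsets of [n] are 'Subset n' (element i+1 of [n] is index i : Fin n).
-- A family of subsets of [n] is given by its characteristic function.

Family : ℕ → Set
Family n = Subset n → Bool

_∈F_ : ∀ {n} → Subset n → Family n → Set
A ∈F 𝓕 = 𝓕 A ≡ true

allSubsets : (n : ℕ) → List (Subset n)
allSubsets zero        = [ [] ]
allSubsets (ℕ.suc n)   = map (true ∷_) (allSubsets n) ++ map (false ∷_) (allSubsets n)

card : ∀ {n} → Family n → ℕ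
card {n} 𝓕 = sum (map (λ A → if 𝓕 A then 1 else 0) (allSubsets n))

initSeg : (n s : ℕ) → Subset n
initSeg n s = tabulate (λ i → toℕ i <ᵇ s)

Uniform : ∀ {n} → ℕ → Family n → Set
Uniform m 𝓕 = ∀ A → A ∈F 𝓕 → ∣ A ∣ ≡ m

CrossIntersecting : ∀ {n} → ℕ → Family n → Family n → Set
CrossIntersecting t 𝓕 𝓖 = ∀ A B → A ∈F 𝓕 → B ∈F 𝓖 → t ℕ.≤ ∣ A ∩ B ∣

hatFamily : (n m s u : ℕ) → Family n
hatFamily n m s u A = (∣ A ∣ ≡ᵇ m) ∧ (u ≤ᵇ ∣ A ∩ initSeg n s ∣)

module _ {c ℓ} (V : OrderedValues c ℓ) where
  open OrderedValues V

  Functional : ℕ → Set c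
  Functional n = Family n → Family n → Carrier

  Symmetric : ∀ {n} → Functional n → Set c
  Symmetric h = ∀ 𝓕 𝓖 𝓕′ 𝓖′ → card 𝓕′ ≡ card 𝓕 → card 𝓖′ ≡ card 𝓖
              → h 𝓕 𝓖 ≡ h 𝓕′ 𝓖′

  -- 𝓕 × 𝓖 ⊆ ⋃_{i} 𝓕ᵢ × 𝓖ᵢ, the pairs (𝓕ᵢ,𝓖ᵢ) given as a list (k = length)
  Covers : ∀ {n} → Family n → Family n → List (Family n × Family n) → Set
  Covers 𝓕 𝓖 ps = ∀ A B → A ∈F 𝓕 → B ∈F 𝓖 →
    Data.List.Relation.Unary.Any.Any (λ { (𝓕ᵢ , 𝓖ᵢ) → (A ∈F 𝓕ᵢ) × (B ∈F 𝓖ᵢ) }) ps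

  SuperAdditive : ∀ {n} → Functional n → Set ℓ
  SuperAdditive h = ∀ 𝓕 𝓖 ps → Covers 𝓕 𝓖 ps
    → h 𝓕 𝓖 ≤ Σ[ map (λ { (𝓕ᵢ , 𝓖ᵢ) → h 𝓕ᵢ 𝓖ᵢ }) ps ]

  Admissible : ∀ {n} → ℕ → ℕ → ℕ → Family n → Family n → Set
  Admissible a b t 𝓕 𝓖 = Uniform a 𝓕 × Uniform b 𝓖 × CrossIntersecting t 𝓕 𝓖

  IsN : (n : ℕ) → Functional n → ℕ → ℕ → ℕ → Carrier → Set (c ⊔ ℓ)
  IsN n h a b t x =
    Σ (Family n) (λ 𝓕 → Σ (Family n) λ 𝓖 → Admissible a b t 𝓕 𝓖 × h 𝓕 𝓖 ≡ x)
    × (∀ 𝓕 𝓖 → Admissible a b t 𝓕 𝓖 → h 𝓕 𝓖 ≤ x)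

  Triple : ℕ → ℕ → ℕ → ℕ → ℕ → Set
  Triple n t u v s = (1 ℕ.≤ u × u ℕ.≤ n) × (1 ℕ.≤ v × v ℕ.≤ n) × (1 ℕ.≤ s × s ℕ.≤ n)
                   × u ℕ.+ v ≡ s ℕ.+ t

  hatValue : (n : ℕ) → Functional n → ℕ → ℕ → ℕ → ℕ → ℕ → Carrier
  hatValue n h a b u v s = h (hatFamily n a s u) (hatFamily n b s v)

  IsN̂ : (n : ℕ) → Functional n → ℕ → ℕ → ℕ → Carrier → Set (c ⊔ ℓ)
  IsN̂ n h a b t x =
    Σ ℕ (λ u → Σ ℕ λ v → Σ ℕ λ s → Triple n t u v s × hatValue n h a b u v s ≡ x)
    × (∀ u v s → Triple n t u v s → hatValue n h a b u v s ≤ x)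

-- The lower bound holds because every pair of hat families with u + v = s + t
-- is itself admissible.  For the upper bound, take a maximising pair (F, G) and
-- apply the adjacent shifts k+1 → k until both families are shifted: shifting
-- preserves uniformity, cross-t-intersection and cardinalities (hence, by
-- symmetry, the value of h), and it terminates since it lowers the total
-- position weight.  For shifted cross-t-intersecting families, every A ∈ F and
-- B ∈ G have a prefix [s] with |A ∩ [s]| + |B ∩ [s]| ≥ s + t (Frankl), so
-- F × G is covered by the n² hat pairs indexed by s and v = |B ∩ [s]|, and
-- super-additivity gives h(F, G) ≤ n² · N̂.

module Submission where

open import Defs
open import Level using (Level)
open import Data.Nat using (ℕ; _≤_; _*_)
open import Data.Product using (_×_)

open import Data.Bool using (Bool; true; false; not; _∧_; _∨_; if_then_else_)
open import Data.Bool.Properties using (∧-identityʳ; T-≡; T-∧) renaming (_≟_ to _≟ᵇ_)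
open import Data.Empty using (⊥; ⊥-elim)
open import Data.Fin.Subset using (Subset; _∩_; ∣_∣) renaming (⊥ to ∅)
open import Data.Fin.Subset.Properties using (∩-comm; ∩-zeroˡ; ∣⊥∣≡0; ∣p∩q∣≤∣q∣)
open import Data.List using (List; []; _∷_; map; _++_; upTo; applyUpTo; cartesianProduct; length)
open import Data.List.Membership.Propositional using (_∈_; lose)
open import Data.List.Membership.Propositional.Properties
  using (∈-map⁺; ∈-++⁺ˡ; ∈-++⁺ʳ; ∈-upTo⁺; ∈-applyUpTo⁺; ∈-cartesianProduct⁺)
open import Data.List.Properties using (map-++; map-∘; length-++; length-map; length-applyUpTo)
open import Data.List.Relation.Unary.Any using (here; any?; satisfied)
import Data.List.Relation.Unary.Any.Properties as Any
open import Data.Nat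
open import Data.Nat.Induction using (<-wellFounded)
open import Data.Nat.ListAction using (sum)
open import Data.Nat.ListAction.Properties using (sum-++)
open import Data.Nat.Properties
open import Algebra.Properties.CommutativeSemigroup +-commutativeSemigroup using (interchange)
open import Data.Product using (∃; ∃-syntax; _,_; proj₁; proj₂)
import Data.Product as Product
open import Data.Sum using (_⊎_; inj₁; inj₂)
import Data.Sum as Sum
open import Data.Unit using (⊤; tt)
open import Data.Vec using ([]; _∷_)
open import Function using (id; _∘′_; Equivalence)
open import Induction.WellFounded using (Acc; acc)
open import Relation.Binary.Bundles using (Preorder)
open import Relation.Binary.PropositionalEquality
import Relation.Binary.Reasoning.Preorder as PreorderReasoning
open import Relation.Nullary using (Dec; yes; no; ¬_)
open import Relation.Nullary.Decidable using (_×-dec_)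
open import Relation.Unary using (Decidable)

-- Adjacent transpositions and position weights

𝟙 : Bool → ℕ
𝟙 b = if b then 1 else 0

∣∷∣ : ∀ {n} x (A : Subset n) → ∣ x ∷ A ∣ ≡ 𝟙 x + ∣ A ∣
∣∷∣ true  A = refl
∣∷∣ false A = refl

-- Positions are counted from 0; an index beyond the end of a vector
-- denotes no element: k ∈ᵇ A is then false, and swap k A = A.
_∈ᵇ_ : ∀ {n} → ℕ → Subset n → Bool
k     ∈ᵇ []      = false
zero  ∈ᵇ (x ∷ A) = x
suc k ∈ᵇ (x ∷ A) = k ∈ᵇ A

swap : ∀ {n} → ℕ → Subset n → Subset n
swap zero    (x ∷ y ∷ A) = y ∷ x ∷ A
swap zero    A           = A
swap (suc k) []          = []
swap (suc k) (x ∷ A)     = x ∷ swap k A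

low : ∀ {n} → ℕ → Subset n → Bool
low zero    (x ∷ y ∷ A) = x ∧ not y
low zero    A           = false
low (suc k) []          = false
low (suc k) (x ∷ A)     = low k A

high : ∀ {n} → ℕ → Subset n → Bool
high zero    (x ∷ y ∷ A) = not x ∧ y
high zero    A           = false
high (suc k) []          = false
high (suc k) (x ∷ A)     = high k A

swap-involutive : ∀ {n} k (A : Subset n) → swap k (swap k A) ≡ A
swap-involutive zero    (x ∷ y ∷ A) = refl
swap-involutive zero    []          = refl
swap-involutive zero    (x ∷ [])    = refl
swap-involutive (suc k) []          = refl
swap-involutive (suc k) (x ∷ A)     = cong (x ∷_) (swap-involutive k A)

low-swap : ∀ {n} k (A : Subset n) → low k (swap k A) ≡ high k A
low-swap zero    (true  ∷ true  ∷ A) = refl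
low-swap zero    (true  ∷ false ∷ A) = refl
low-swap zero    (false ∷ true  ∷ A) = refl
low-swap zero    (false ∷ false ∷ A) = refl
low-swap zero    []              = refl
low-swap zero    (x ∷ [])        = refl
low-swap (suc k) []              = refl
low-swap (suc k) (x ∷ A)         = low-swap k A

high-swap : ∀ {n} k (A : Subset n) → high k (swap k A) ≡ low k A
high-swap k A = begin
  high k (swap k A)               ≡⟨ low-swap k (swap k A) ⟨
  low k (swap k (swap k A))       ≡⟨ cong (low k) (swap-involutive k A) ⟩
  low k A                         ∎
  where open ≡-Reasoning

low∧high : ∀ {n} k (A : Subset n) → low k A ∧ high k A ≡ false
low∧high zero    (true  ∷ true  ∷ A) = refl
low∧high zero    (true  ∷ false ∷ A) = refl
low∧high zero    (false ∷ true  ∷ A) = refl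
low∧high zero    (false ∷ false ∷ A) = refl
low∧high zero    []              = refl
low∧high zero    (x ∷ [])        = refl
low∧high (suc k) []              = refl
low∧high (suc k) (x ∷ A)         = low∧high k A

high⇒<length : ∀ {n} k (A : Subset n) → high k A ≡ true → k < n
high⇒<length zero    (x ∷ y ∷ A) _ = s≤s z≤n
high⇒<length (suc k) (x ∷ A)     h = s≤s (high⇒<length k A h)

∣swap∣ : ∀ {n} k (A : Subset n) → ∣ swap k A ∣ ≡ ∣ A ∣
∣swap∣ zero    (true  ∷ true  ∷ A) = refl
∣swap∣ zero    (true  ∷ false ∷ A) = refl
∣swap∣ zero    (false ∷ true  ∷ A) = refl
∣swap∣ zero    (false ∷ false ∷ A) = refl
∣swap∣ zero    []                  = refl
∣swap∣ zero    (x ∷ [])            = refl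
∣swap∣ (suc k) []                  = refl
∣swap∣ (suc k) (x ∷ A)             = begin
  ∣ x ∷ swap k A ∣   ≡⟨ ∣∷∣ x (swap k A) ⟩
  𝟙 x + ∣ swap k A ∣ ≡⟨ cong (𝟙 x +_) (∣swap∣ k A) ⟩
  𝟙 x + ∣ A ∣        ≡⟨ ∣∷∣ x A ⟨
  ∣ x ∷ A ∣          ∎
  where open ≡-Reasoning

swap-∩ : ∀ {n} k (A B : Subset n) → swap k A ∩ swap k B ≡ swap k (A ∩ B)
swap-∩ zero    (x ∷ y ∷ A) (x′ ∷ y′ ∷ B) = refl
swap-∩ zero    []          []            = refl
swap-∩ zero    (x ∷ [])    (x′ ∷ [])     = refl
swap-∩ (suc k) []          []            = refl
swap-∩ (suc k) (x ∷ A)     (x′ ∷ B)      = cong ((x ∧ x′) ∷_) (swap-∩ k A B)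

∣swap-∩-swap∣ : ∀ {n} k (A B : Subset n) → ∣ swap k A ∩ swap k B ∣ ≡ ∣ A ∩ B ∣
∣swap-∩-swap∣ k A B = trans (cong ∣_∣ (swap-∩ k A B)) (∣swap∣ k (A ∩ B))

∣swap-∩∣≤ : ∀ {n} k (A B : Subset n) → low k A ≡ true → high k B ≡ false →
            ∣ swap k A ∩ B ∣ ≤ ∣ A ∩ B ∣
∣swap-∩∣≤ zero    (true ∷ false ∷ A) (true  ∷ true  ∷ B) _ _ = ≤-refl
∣swap-∩∣≤ zero    (true ∷ false ∷ A) (true  ∷ false ∷ B) _ _ = n≤1+n _
∣swap-∩∣≤ zero    (true ∷ false ∷ A) (false ∷ false ∷ B) _ _ = ≤-refl
∣swap-∩∣≤ (suc k) (x ∷ A)            (y ∷ B)             l h = begin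
  ∣ (x ∧ y) ∷ (swap k A ∩ B) ∣ ≡⟨ ∣∷∣ (x ∧ y) (swap k A ∩ B) ⟩
  𝟙 (x ∧ y) + ∣ swap k A ∩ B ∣ ≤⟨ +-monoʳ-≤ (𝟙 (x ∧ y)) (∣swap-∩∣≤ k A B l h) ⟩
  𝟙 (x ∧ y) + ∣ A ∩ B ∣        ≡⟨ ∣∷∣ (x ∧ y) (A ∩ B) ⟨
  ∣ (x ∧ y) ∷ (A ∩ B) ∣        ∎
  where open ≤-Reasoning

-- The sum of the positions of the elements of A.
weight : ∀ {n} → Subset n → ℕ
weight []      = 0
weight (x ∷ A) = weight A + ∣ A ∣

weight-high : ∀ {n} k (A : Subset n) → high k A ≡ true → weight A ≡ suc (weight (swap k A))
weight-high zero    (false ∷ true ∷ A) _ = +-suc (weight A + ∣ A ∣) ∣ A ∣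
weight-high (suc k) (x ∷ A)            h = cong₂ _+_ (weight-high k A h) (sym (∣swap∣ k A))

-- Sums over all subsets of [n]

sumSubsets : ∀ n → (Subset n → ℕ) → ℕ
sumSubsets zero    f = f []
sumSubsets (suc n) f = sumSubsets n (λ A → f (true ∷ A)) + sumSubsets n (λ A → f (false ∷ A))

sum-allSubsets : ∀ n (f : Subset n → ℕ) → sum (map f (allSubsets n)) ≡ sumSubsets n f
sum-allSubsets zero    f = +-identityʳ (f [])
sum-allSubsets (suc n) f = begin
  sum (map f (map (true ∷_) L ++ map (false ∷_) L))
    ≡⟨ cong sum (map-++ f (map (true ∷_) L) (map (false ∷_) L)) ⟩
  sum (map f (map (true ∷_) L) ++ map f (map (false ∷_) L))
    ≡⟨ sum-++ (map f (map (true ∷_) L)) _ ⟩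
  sum (map f (map (true ∷_) L)) + sum (map f (map (false ∷_) L))
    ≡⟨ cong₂ _+_ (cong sum (map-∘ L)) (cong sum (map-∘ L)) ⟨
  sum (map (λ A → f (true ∷ A)) L) + sum (map (λ A → f (false ∷ A)) L)
    ≡⟨ cong₂ _+_ (sum-allSubsets n _) (sum-allSubsets n _) ⟩
  sumSubsets (suc n) f ∎
  where
  open ≡-Reasoning
  L = allSubsets n

card≡sumSubsets : ∀ {n} (F : Family n) → card F ≡ sumSubsets n (λ A → 𝟙 (F A))
card≡sumSubsets {n} F = sum-allSubsets n (λ A → 𝟙 (F A))

∈-allSubsets : ∀ {n} (A : Subset n) → A ∈ allSubsets n
∈-allSubsets []          = here refl
∈-allSubsets (true  ∷ A) = ∈-++⁺ˡ (∈-map⁺ (true ∷_) (∈-allSubsets A))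
∈-allSubsets (false ∷ A) = ∈-++⁺ʳ (map (true ∷_) (allSubsets _)) (∈-map⁺ (false ∷_) (∈-allSubsets A))

sumSubsets-cong : ∀ n {f g : Subset n → ℕ} → (∀ A → f A ≡ g A) → sumSubsets n f ≡ sumSubsets n g
sumSubsets-cong zero    f≡g = f≡g []
sumSubsets-cong (suc n) f≡g =
  cong₂ _+_ (sumSubsets-cong n (λ A → f≡g (true ∷ A))) (sumSubsets-cong n (λ A → f≡g (false ∷ A)))

sumSubsets-mono-≤ : ∀ n {f g : Subset n → ℕ} → (∀ A → f A ≤ g A) → sumSubsets n f ≤ sumSubsets n g
sumSubsets-mono-≤ zero    f≤g = f≤g []
sumSubsets-mono-≤ (suc n) f≤g =
  +-mono-≤ (sumSubsets-mono-≤ n (λ A → f≤g (true ∷ A))) (sumSubsets-mono-≤ n (λ A → f≤g (false ∷ A)))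

sumSubsets-mono-< : ∀ n {f g : Subset n → ℕ} → (∀ A → f A ≤ g A) →
                    ∀ A₀ → f A₀ < g A₀ → sumSubsets n f < sumSubsets n g
sumSubsets-mono-< zero    f≤g [] f<g = f<g
sumSubsets-mono-< (suc n) f≤g (true ∷ A₀) f<g = +-mono-<-≤
  (sumSubsets-mono-< n (λ A → f≤g (true ∷ A)) A₀ f<g) (sumSubsets-mono-≤ n (λ A → f≤g (false ∷ A)))
sumSubsets-mono-< (suc n) f≤g (false ∷ A₀) f<g = +-mono-≤-<
  (sumSubsets-mono-≤ n (λ A → f≤g (true ∷ A))) (sumSubsets-mono-< n (λ A → f≤g (false ∷ A)) A₀ f<g)

sumSubsets-+ : ∀ n (f g : Subset n → ℕ) →
               sumSubsets n (λ A → f A + g A) ≡ sumSubsets n f + sumSubsets n g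
sumSubsets-+ zero    f g = refl
sumSubsets-+ (suc n) f g = trans
  (cong₂ _+_ (sumSubsets-+ n _ _) (sumSubsets-+ n _ _))
  (interchange (sumSubsets n (λ A → f (true ∷ A))) _ (sumSubsets n (λ A → f (false ∷ A))) _)

sumSubsets-swap : ∀ n k (f : Subset n → ℕ) → sumSubsets n (λ A → f (swap k A)) ≡ sumSubsets n f
sumSubsets-swap zero          zero    f = refl
sumSubsets-swap (suc zero)    zero    f = refl
sumSubsets-swap (suc (suc n)) zero    f = interchange
  (sumSubsets n (λ A → f (true ∷ true ∷ A)))  (sumSubsets n (λ A → f (false ∷ true ∷ A)))
  (sumSubsets n (λ A → f (true ∷ false ∷ A))) (sumSubsets n (λ A → f (false ∷ false ∷ A)))
sumSubsets-swap zero          (suc k) f = refl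
sumSubsets-swap (suc n)       (suc k) f =
  cong₂ _+_ (sumSubsets-swap n k (λ A → f (true ∷ A))) (sumSubsets-swap n k (λ A → f (false ∷ A)))

sumSubsets-pairs : ∀ n k (f : Subset n → ℕ) →
                   sumSubsets n (λ A → f A + f (swap k A)) ≡ 2 * sumSubsets n f
sumSubsets-pairs n k f = begin
  sumSubsets n (λ A → f A + f (swap k A))
    ≡⟨ sumSubsets-+ n f (λ A → f (swap k A)) ⟩
  sumSubsets n f + sumSubsets n (λ A → f (swap k A))
    ≡⟨ cong (sumSubsets n f +_) (sumSubsets-swap n k f) ⟩
  sumSubsets n f + sumSubsets n f
    ≡⟨ cong (sumSubsets n f +_) (+-identityʳ _) ⟨
  2 * sumSubsets n f ∎
  where open ≡-Reasoning

-- Shifting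

-- The shift k+1 → k: of each pair {A, swap k A} meeting F, the shifted family
-- contains the low member (k ∈ A, k+1 ∉ A), and the high one only if both
-- were in F.
shiftᵇ : (isLow isHigh inF partnerInF : Bool) → Bool
shiftᵇ true  _     x y = x ∨ y
shiftᵇ false true  x y = x ∧ y
shiftᵇ false false x y = x

shift : ∀ {n} → ℕ → Family n → Family n
shift k F A = shiftᵇ (low k A) (high k A) (F A) (F (swap k A))

shift-swap : ∀ {n} k (F : Family n) A →
             shift k F (swap k A) ≡ shiftᵇ (high k A) (low k A) (F (swap k A)) (F A)
shift-swap k F A rewrite low-swap k A | high-swap k A | swap-involutive k A = refl

shiftᵇ-pair-𝟙 : ∀ l h x y → l ∧ h ≡ false →
                𝟙 (shiftᵇ l h x y) + 𝟙 (shiftᵇ h l y x) ≡ 𝟙 x + 𝟙 y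
shiftᵇ-pair-𝟙 true  false true  true  _ = refl
shiftᵇ-pair-𝟙 true  false true  false _ = refl
shiftᵇ-pair-𝟙 true  false false true  _ = refl
shiftᵇ-pair-𝟙 true  false false false _ = refl
shiftᵇ-pair-𝟙 false true  true  true  _ = refl
shiftᵇ-pair-𝟙 false true  true  false _ = refl
shiftᵇ-pair-𝟙 false true  false true  _ = refl
shiftᵇ-pair-𝟙 false true  false false _ = refl
shiftᵇ-pair-𝟙 false false x     y     _ = refl

card-shift : ∀ {n} k (F : Family n) → card (shift k F) ≡ card F
card-shift {n} k F = *-cancelˡ-≡ _ _ 2 (begin
  2 * card (shift k F)
    ≡⟨ cong (2 *_) (card≡sumSubsets (shift k F)) ⟩
  2 * sumSubsets n (λ A → 𝟙 (shift k F A))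
    ≡⟨ sumSubsets-pairs n k (λ A → 𝟙 (shift k F A)) ⟨
  sumSubsets n (λ A → 𝟙 (shift k F A) + 𝟙 (shift k F (swap k A)))
    ≡⟨ sumSubsets-cong n pair ⟩
  sumSubsets n (λ A → 𝟙 (F A) + 𝟙 (F (swap k A)))
    ≡⟨ sumSubsets-pairs n k (λ A → 𝟙 (F A)) ⟩
  2 * sumSubsets n (λ A → 𝟙 (F A))
    ≡⟨ cong (2 *_) (card≡sumSubsets F) ⟨
  2 * card F ∎)
  where
  open ≡-Reasoning
  pair : ∀ A → 𝟙 (shift k F A) + 𝟙 (shift k F (swap k A)) ≡ 𝟙 (F A) + 𝟙 (F (swap k A))
  pair A rewrite shift-swap k F A = shiftᵇ-pair-𝟙 (low k A) (high k A) _ _ (low∧high k A)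

weightIf : Bool → ℕ → ℕ
weightIf b w = if b then w else 0

familyWeight : ∀ {n} → Family n → ℕ
familyWeight {n} F = sumSubsets n (λ A → weightIf (F A) (weight A))

shiftᵇ-pair-weight : ∀ l h x y wx wy → l ∧ h ≡ false →
  (l ≡ true → wy ≡ suc wx) → (h ≡ true → wx ≡ suc wy) →
  weightIf (shiftᵇ l h x y) wx + weightIf (shiftᵇ h l y x) wy ≤ weightIf x wx + weightIf y wy
shiftᵇ-pair-weight true  false true  true  wx wy _ _ _ = ≤-refl
shiftᵇ-pair-weight true  false true  false wx wy _ _ _ = ≤-refl
shiftᵇ-pair-weight true  false false true  wx wy _ l _ rewrite l refl =
  ≤-trans (≤-reflexive (+-identityʳ wx)) (n≤1+n wx)
shiftᵇ-pair-weight true  false false false wx wy _ _ _ = ≤-refl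
shiftᵇ-pair-weight false true  true  true  wx wy _ _ _ = ≤-refl
shiftᵇ-pair-weight false true  true  false wx wy _ _ h rewrite h refl =
  ≤-trans (n≤1+n wy) (≤-reflexive (sym (+-identityʳ (suc wy))))
shiftᵇ-pair-weight false true  false true  wx wy _ _ _ = ≤-refl
shiftᵇ-pair-weight false true  false false wx wy _ _ _ = ≤-refl
shiftᵇ-pair-weight false false x     y     wx wy _ _ _ = ≤-refl

weight-low : ∀ {n} k (A : Subset n) → low k A ≡ true → weight (swap k A) ≡ suc (weight A)
weight-low k A l = begin
  weight (swap k A)                  ≡⟨ weight-high k (swap k A) (trans (high-swap k A) l) ⟩
  suc (weight (swap k (swap k A)))   ≡⟨ cong (suc ∘′ weight) (swap-involutive k A) ⟩
  suc (weight A)                     ∎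
  where open ≡-Reasoning

high⇒¬low : ∀ {n} k (A : Subset n) → high k A ≡ true → low k A ≡ false
high⇒¬low k A h =
  trans (sym (∧-identityʳ (low k A))) (subst (λ b → low k A ∧ b ≡ false) h (low∧high k A))

module _ {n} (k : ℕ) (F : Family n) where

  private
    weightIn : Family n → Subset n → ℕ
    weightIn G A = weightIf (G A) (weight A)

    pairWeight : Family n → ℕ
    pairWeight G = sumSubsets n (λ A → weightIn G A + weightIn G (swap k A))

    pairWeight≡ : ∀ G → pairWeight G ≡ 2 * familyWeight G
    pairWeight≡ G = sumSubsets-pairs n k (weightIn G)

    shift-pair-weight : ∀ A → weightIn (shift k F) A + weightIn (shift k F) (swap k A)
                              ≤ weightIn F A + weightIn F (swap k A)
    shift-pair-weight A rewrite shift-swap k F A = shiftᵇ-pair-weight (low k A) (high k A) _ _ _ _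
      (low∧high k A) (weight-low k A) (weight-high k A)

  familyWeight-shift-≤ : familyWeight (shift k F) ≤ familyWeight F
  familyWeight-shift-≤ = *-cancelˡ-≤ 2 (subst₂ _≤_ (pairWeight≡ (shift k F)) (pairWeight≡ F)
    (sumSubsets-mono-≤ n shift-pair-weight))

  familyWeight-shift-< : ∀ A → high k A ≡ true → A ∈F F → F (swap k A) ≡ false →
                         familyWeight (shift k F) < familyWeight F
  familyWeight-shift-< A₀ h A₀∈F sA₀∉F = *-cancelˡ-< 2 _ _
    (subst₂ _<_ (pairWeight≡ (shift k F)) (pairWeight≡ F) (sumSubsets-mono-< n shift-pair-weight A₀ moved))
    where
    moved : weightIn (shift k F) A₀ + weightIn (shift k F) (swap k A₀)
            < weightIn F A₀ + weightIn F (swap k A₀)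
    moved rewrite shift-swap k F A₀ | high⇒¬low k A₀ h | h | A₀∈F | sA₀∉F
      = ≤-reflexive (trans (sym (weight-high k A₀ h)) (sym (+-identityʳ (weight A₀))))

shiftᵇ-true : ∀ l h x y → shiftᵇ l h x y ≡ true → x ≡ true ⊎ (l ≡ true × y ≡ true)
shiftᵇ-true true  h     true  y _ = inj₁ refl
shiftᵇ-true true  h     false y e = inj₂ (refl , e)
shiftᵇ-true false true  true  y _ = inj₁ refl
shiftᵇ-true false false x     y e = inj₁ e

shift-∈ : ∀ {n} k (F : Family n) A → A ∈F shift k F → A ∈F F ⊎ (low k A ≡ true × swap k A ∈F F)
shift-∈ k F A = shiftᵇ-true (low k A) (high k A) (F A) (F (swap k A))

shift-∈-high : ∀ {n} k (F : Family n) A → high k A ≡ true → A ∈F shift k F → A ∈F F × swap k A ∈F F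
shift-∈-high k F A h A∈ = both (F A) (F (swap k A))
  (subst₂ (λ l h′ → shiftᵇ l h′ (F A) (F (swap k A)) ≡ true) (high⇒¬low k A h) h A∈)
  where
  both : ∀ x y → shiftᵇ false true x y ≡ true → x ≡ true × y ≡ true
  both true true _ = refl , refl

shift-uniform : ∀ {n} k {m} {F : Family n} → Uniform m F → Uniform m (shift k F)
shift-uniform k {F = F} uF A A∈ with shift-∈ k F A A∈
... | inj₁ A∈F           = uF A A∈F
... | inj₂ (_ , swapA∈F) = trans (sym (∣swap∣ k A)) (uF (swap k A) swapA∈F)

cross-sym : ∀ {n t} {F G : Family n} → CrossIntersecting t F G → CrossIntersecting t G F
cross-sym {t = t} cr B A B∈G A∈F = subst (t ≤_) (cong ∣_∣ (∩-comm A B)) (cr A B A∈F B∈G)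

shift-cross-low : ∀ {n t} k {F G : Family n} {A B} → CrossIntersecting t F G →
                  low k A ≡ true → swap k A ∈F F → B ∈F shift k G → t ≤ ∣ A ∩ B ∣
shift-cross-low {t = t} k {G = G} {A} {B} cr l sA∈F B∈ with shift-∈ k G B B∈ | high k B in hB
... | inj₂ (_ , sB∈G) | _     = subst (t ≤_) (∣swap-∩-swap∣ k A B) (cr _ _ sA∈F sB∈G)
... | inj₁ B∈G        | true  =
  subst (t ≤_) (∣swap-∩-swap∣ k A B) (cr _ _ sA∈F (proj₂ (shift-∈-high k G B hB B∈)))
... | inj₁ B∈G        | false = ≤-trans (cr _ _ sA∈F B∈G) (∣swap-∩∣≤ k A B l hB)

shift-cross : ∀ {n t} k {F G : Family n} → CrossIntersecting t F G →
              CrossIntersecting t (shift k F) (shift k G)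
shift-cross {t = t} k {F} {G} cr A B A∈ B∈ with shift-∈ k F A A∈ | shift-∈ k G B B∈
... | inj₂ (l , sA∈F) | _               = shift-cross-low k cr l sA∈F B∈
... | inj₁ A∈F        | inj₁ B∈G        = cr A B A∈F B∈G
... | inj₁ _          | inj₂ (l , sB∈G) =
  subst (t ≤_) (cong ∣_∣ (∩-comm B A)) (shift-cross-low k (cross-sym cr) l sB∈G A∈)

Shifted : ∀ {n} → Family n → Set
Shifted F = ∀ k A → high k A ≡ true → A ∈F F → swap k A ∈F F

ShiftViolation : ∀ {n} → Family n → ℕ × Subset n → Set
ShiftViolation F (k , A) = high k A ≡ true × A ∈F F × F (swap k A) ≡ false

shiftViolation? : ∀ {n} (F : Family n) → Decidable (ShiftViolation F)
shiftViolation? F (k , A) = (high k A ≟ᵇ true) ×-dec (F A ≟ᵇ true) ×-dec (F (swap k A) ≟ᵇ false)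

shifted⊎violation : ∀ {n} (F : Family n) → Shifted F ⊎ ∃ (ShiftViolation F)
shifted⊎violation {n} F with any? (shiftViolation? F) (cartesianProduct (upTo n) (allSubsets n))
... | yes v = inj₂ (satisfied v)
... | no ¬v = inj₁ shifted
  where
  shifted : Shifted F
  shifted k A h A∈F with F (swap k A) in e
  ... | true  = refl
  ... | false = ⊥-elim (¬v (lose (∈-cartesianProduct⁺ (∈-upTo⁺ (high⇒<length k A h)) (∈-allSubsets A))
                                 (h , A∈F , e)))

shifted⊎shift-lighter : ∀ {n} (F G : Family n) → (Shifted F × Shifted G) ⊎
  ∃[ k ] familyWeight (shift k F) + familyWeight (shift k G) < familyWeight F + familyWeight G
shifted⊎shift-lighter F G with shifted⊎violation F | shifted⊎violation G
... | inj₂ ((k , A) , h , A∈F , e) | _ =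
  inj₂ (k , +-mono-<-≤ (familyWeight-shift-< k F A h A∈F e) (familyWeight-shift-≤ k G))
... | inj₁ _ | inj₂ ((k , B) , h , B∈G , e) =
  inj₂ (k , +-mono-≤-< (familyWeight-shift-≤ k F) (familyWeight-shift-< k G B h B∈G e))
... | inj₁ sF | inj₁ sG = inj₁ (sF , sG)

record ShiftedCopy {n} (a b t : ℕ) (F G : Family n) : Set where
  field
    F′ G′      : Family n
    uniform-F′ : Uniform a F′
    uniform-G′ : Uniform b G′
    cross      : CrossIntersecting t F′ G′
    card-F′    : card F′ ≡ card F
    card-G′    : card G′ ≡ card G
    shifted-F′ : Shifted F′
    shifted-G′ : Shifted G′

shiftedCopy-shift : ∀ {n a b t} k {F G : Family n} →
                    ShiftedCopy a b t (shift k F) (shift k G) → ShiftedCopy a b t F G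
shiftedCopy-shift k {F} {G} c = record
  { F′ = F′ ; G′ = G′ ; uniform-F′ = uniform-F′ ; uniform-G′ = uniform-G′ ; cross = cross
  ; card-F′ = trans card-F′ (card-shift k F) ; card-G′ = trans card-G′ (card-shift k G)
  ; shifted-F′ = shifted-F′ ; shifted-G′ = shifted-G′ }
  where open ShiftedCopy c

shiftedCopy : ∀ {n a b t} (F G : Family n) → Uniform a F → Uniform b G → CrossIntersecting t F G →
              ShiftedCopy a b t F G
shiftedCopy F G uF uG cr = go F G uF uG cr (<-wellFounded _)
  where
  go : ∀ {n a b t} (F G : Family n) → Uniform a F → Uniform b G → CrossIntersecting t F G →
       Acc _<_ (familyWeight F + familyWeight G) → ShiftedCopy a b t F G
  go F G uF uG cr (acc rec) with shifted⊎shift-lighter F G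
  ... | inj₁ (sF , sG) = record
    { F′ = F ; G′ = G ; uniform-F′ = uF ; uniform-G′ = uG ; cross = cr
    ; card-F′ = refl ; card-G′ = refl ; shifted-F′ = sF ; shifted-G′ = sG }
  ... | inj₂ (k , lighter) = shiftedCopy-shift k
    (go (shift k F) (shift k G) (shift-uniform k uF) (shift-uniform k uG) (shift-cross k cr)
        (rec lighter))

-- Frankl's prefix lemma for shifted cross-intersecting families

prefix : ∀ {n} → ℕ → Subset n → ℕ
prefix s A = ∣ A ∩ initSeg _ s ∣

∣initSeg∣≤ : ∀ n s → ∣ initSeg n s ∣ ≤ s
∣initSeg∣≤ zero    s       = z≤n
∣initSeg∣≤ (suc n) zero    = ∣initSeg∣≤ n zero
∣initSeg∣≤ (suc n) (suc s) = s≤s (∣initSeg∣≤ n s)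

prefix≤ : ∀ {n} s (A : Subset n) → prefix s A ≤ s
prefix≤ {n} s A = ≤-trans (∣p∩q∣≤∣q∣ A (initSeg n s)) (∣initSeg∣≤ n s)

prefix-+≤ : ∀ {n} s (A B : Subset n) → prefix s A + prefix s B ≤ s + ∣ A ∩ B ∣
prefix-+≤ zero    A           B           = ≤-trans (+-mono-≤ (prefix≤ 0 A) (prefix≤ 0 B)) z≤n
prefix-+≤ (suc s) []          []          = z≤n
prefix-+≤ (suc s) (true  ∷ A) (true  ∷ B) = s≤s (subst₂ _≤_
  (sym (+-suc (prefix s A) (prefix s B))) (sym (+-suc s ∣ A ∩ B ∣)) (s≤s (prefix-+≤ s A B)))
prefix-+≤ (suc s) (true  ∷ A) (false ∷ B) = s≤s (prefix-+≤ s A B)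
prefix-+≤ (suc s) (false ∷ A) (true  ∷ B) =
  subst (_≤ suc s + ∣ A ∩ B ∣) (sym (+-suc (prefix s A) (prefix s B))) (s≤s (prefix-+≤ s A B))
prefix-+≤ (suc s) (false ∷ A) (false ∷ B) = ≤-trans (prefix-+≤ s A B) (n≤1+n _)

-- PrefixBounded r A B says prefix s A + prefix s B ≤ s + r for every s ≥ 1;
-- the index is the slack left after the positions read so far.
PrefixBounded : ∀ {n} → ℕ → Subset n → Subset n → Set
PrefixBounded r       []          []          = ⊤
PrefixBounded r       (false ∷ A) (false ∷ B) = PrefixBounded (suc r) A B
PrefixBounded r       (false ∷ A) (true  ∷ B) = PrefixBounded r A B
PrefixBounded r       (true  ∷ A) (false ∷ B) = PrefixBounded r A B
PrefixBounded zero    (true  ∷ A) (true  ∷ B) = ⊥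
PrefixBounded (suc r) (true  ∷ A) (true  ∷ B) = PrefixBounded r A B

DensePrefix : ∀ {n} → ℕ → Subset n → Subset n → Set
DensePrefix {n} t A B = ∃[ s ] 1 ≤ s × s ≤ n × s + t ≤ prefix s A + prefix s B

prefixBounded⊎dense : ∀ {n} r (A B : Subset n) → PrefixBounded r A B ⊎ DensePrefix (suc r) A B
prefixBounded⊎dense r       []          []          = inj₁ tt
prefixBounded⊎dense zero    (true  ∷ A) (true  ∷ B) =
  inj₂ (1 , s≤s z≤n , s≤s z≤n , +-mono-≤ (s≤s z≤n) (s≤s z≤n))
prefixBounded⊎dense (suc r) (true  ∷ A) (true  ∷ B) = Sum.map₂ step (prefixBounded⊎dense r A B)
  where
  step : DensePrefix (suc r) A B → DensePrefix (suc (suc r)) (true ∷ A) (true ∷ B)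
  step (s , _ , s≤n , dense) = suc s , s≤s z≤n , s≤s s≤n , s≤s (subst₂ _≤_
    (sym (+-suc s (suc r))) (sym (+-suc (prefix s A) (prefix s B))) (s≤s dense))
prefixBounded⊎dense r       (true  ∷ A) (false ∷ B) = Sum.map₂ step (prefixBounded⊎dense r A B)
  where
  step : DensePrefix (suc r) A B → DensePrefix (suc r) (true ∷ A) (false ∷ B)
  step (s , _ , s≤n , dense) = suc s , s≤s z≤n , s≤s s≤n , s≤s dense
prefixBounded⊎dense r       (false ∷ A) (true  ∷ B) = Sum.map₂ step (prefixBounded⊎dense r A B)
  where
  step : DensePrefix (suc r) A B → DensePrefix (suc r) (false ∷ A) (true ∷ B)
  step (s , _ , s≤n , dense) = suc s , s≤s z≤n , s≤s s≤n ,
    subst (suc (s + suc r) ≤_) (sym (+-suc (prefix s A) (prefix s B))) (s≤s dense)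
prefixBounded⊎dense r       (false ∷ A) (false ∷ B) = Sum.map₂ step (prefixBounded⊎dense (suc r) A B)
  where
  step : DensePrefix (suc (suc r)) A B → DensePrefix (suc r) (false ∷ A) (false ∷ B)
  step (s , _ , s≤n , dense) = suc s , s≤s z≤n , s≤s s≤n ,
    subst (_≤ prefix s A + prefix s B) (+-suc s (suc r)) dense

PrefixBounded-sym : ∀ {n} r (A B : Subset n) → PrefixBounded r A B → PrefixBounded r B A
PrefixBounded-sym r       []          []          = id
PrefixBounded-sym r       (false ∷ A) (false ∷ B) = PrefixBounded-sym (suc r) A B
PrefixBounded-sym r       (false ∷ A) (true  ∷ B) = PrefixBounded-sym r A B
PrefixBounded-sym r       (true  ∷ A) (false ∷ B) = PrefixBounded-sym r A B
PrefixBounded-sym (suc r) (true  ∷ A) (true  ∷ B) = PrefixBounded-sym r A B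

PrefixBounded-swap : ∀ {n} k r (A B : Subset n) → high k A ≡ true → k ∈ᵇ B ≡ false →
                     PrefixBounded r A B → PrefixBounded r (swap k A) B
PrefixBounded-swap zero    r       (false ∷ true ∷ A) (false ∷ true  ∷ B) _ _ p = p
PrefixBounded-swap zero    r       (false ∷ true ∷ A) (false ∷ false ∷ B) _ _ p = p
PrefixBounded-swap (suc k) (suc r) (true  ∷ A)        (true  ∷ B)         = PrefixBounded-swap k r A B
PrefixBounded-swap (suc k) r       (true  ∷ A)        (false ∷ B)         = PrefixBounded-swap k r A B
PrefixBounded-swap (suc k) r       (false ∷ A)        (true  ∷ B)         = PrefixBounded-swap k r A B
PrefixBounded-swap (suc k) r       (false ∷ A)        (false ∷ B)         = PrefixBounded-swap k (suc r) A B

InitialUnion : ∀ {n} → Subset n → Subset n → Set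
InitialUnion []          []          = ⊤
InitialUnion (false ∷ A) (false ∷ B) = A ≡ ∅ × B ≡ ∅
InitialUnion (false ∷ A) (true  ∷ B) = InitialUnion A B
InitialUnion (true  ∷ A) (y     ∷ B) = InitialUnion A B

Compressible : ∀ {n} → Subset n → Subset n → Set
Compressible A B = ∃[ k ] high k A ≡ true × k ∈ᵇ B ≡ false

compressible-∷ : ∀ {n x y} {A B : Subset n} → Compressible A B → Compressible (x ∷ A) (y ∷ B)
compressible-∷ (k , hA , k∉B) = suc k , hA , k∉B

initialUnion⊎compressible-∷ : ∀ {n x y} {A B : Subset n} →
  (InitialUnion A B → InitialUnion (x ∷ A) (y ∷ B)) →
  InitialUnion A B ⊎ (Compressible A B ⊎ Compressible B A) →
  InitialUnion (x ∷ A) (y ∷ B) ⊎ (Compressible (x ∷ A) (y ∷ B) ⊎ Compressible (y ∷ B) (x ∷ A))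
initialUnion⊎compressible-∷ f = Sum.map f (Sum.map compressible-∷ compressible-∷)

initialUnion⊎compressible : ∀ {n} (A B : Subset n) →
                            InitialUnion A B ⊎ (Compressible A B ⊎ Compressible B A)
initialUnion⊎compressible []                  []                  = inj₁ tt
initialUnion⊎compressible (false ∷ [])        (false ∷ [])        = inj₁ (refl , refl)
initialUnion⊎compressible (false ∷ true ∷ A)  (false ∷ y ∷ B)     = inj₂ (inj₁ (0 , refl , refl))
initialUnion⊎compressible (false ∷ false ∷ A) (false ∷ true ∷ B)  = inj₂ (inj₂ (0 , refl , refl))
initialUnion⊎compressible (false ∷ false ∷ A) (false ∷ false ∷ B) =
  initialUnion⊎compressible-∷ (Product.map (cong (false ∷_)) (cong (false ∷_)))
    (initialUnion⊎compressible (false ∷ A) (false ∷ B))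
initialUnion⊎compressible (false ∷ A)         (true ∷ B)          =
  initialUnion⊎compressible-∷ id (initialUnion⊎compressible A B)
initialUnion⊎compressible (true ∷ A)          (y ∷ B)             =
  initialUnion⊎compressible-∷ id (initialUnion⊎compressible A B)

initialUnion-∣∩∣≤ : ∀ {n} r (A B : Subset n) → InitialUnion A B → PrefixBounded r A B → ∣ A ∩ B ∣ ≤ r
initialUnion-∣∩∣≤ r       []          []          _ _ = z≤n
initialUnion-∣∩∣≤ {suc n} r (false ∷ A) (false ∷ B) (refl , _) _ =
  subst (_≤ r) (sym (trans (cong ∣_∣ (∩-zeroˡ B)) (∣⊥∣≡0 n))) z≤n
initialUnion-∣∩∣≤ r       (false ∷ A) (true  ∷ B) = initialUnion-∣∩∣≤ r A B
initialUnion-∣∩∣≤ r       (true  ∷ A) (false ∷ B) = initialUnion-∣∩∣≤ r A B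
initialUnion-∣∩∣≤ (suc r) (true  ∷ A) (true  ∷ B) u p = s≤s (initialUnion-∣∩∣≤ r A B u p)

weight-swap-< : ∀ {n} k (A : Subset n) → high k A ≡ true → weight (swap k A) < weight A
weight-swap-< k A hA = ≤-reflexive (sym (weight-high k A hA))

-- For shifted families, compressing A or B at a position missing from the
-- other keeps both in their families and keeps the prefix bound, until A ∪ B
-- is an initial segment; there the bound forces |A ∩ B| ≤ r.
shifted-cross⇒¬prefixBounded : ∀ {n r} {F G : Family n} → Shifted F → Shifted G →
  CrossIntersecting (suc r) F G → ∀ {A B} → A ∈F F → B ∈F G → ¬ PrefixBounded r A B
shifted-cross⇒¬prefixBounded {r = r} {F} {G} sF sG cr A∈F B∈G = go _ _ A∈F B∈G (<-wellFounded _)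
  where
  go : ∀ A B → A ∈F F → B ∈F G → Acc _<_ (weight A + weight B) → ¬ PrefixBounded r A B
  go A B A∈F B∈G (acc rec) p with initialUnion⊎compressible A B
  ... | inj₁ u = <⇒≱ (s≤s (initialUnion-∣∩∣≤ r A B u p)) (cr A B A∈F B∈G)
  ... | inj₂ (inj₁ (k , hA , k∉B)) =
    go (swap k A) B (sF k A hA A∈F) B∈G (rec (+-monoˡ-< (weight B) (weight-swap-< k A hA)))
       (PrefixBounded-swap k r A B hA k∉B p)
  ... | inj₂ (inj₂ (k , hB , k∉A)) =
    go A (swap k B) A∈F (sG k B hB B∈G) (rec (+-monoʳ-< (weight A) (weight-swap-< k B hB)))
       (PrefixBounded-sym r (swap k B) A (PrefixBounded-swap k r B A hB k∉A (PrefixBounded-sym r A B p)))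

shifted-cross⇒densePrefix : ∀ {n r} {F G : Family n} → Shifted F → Shifted G →
  CrossIntersecting (suc r) F G → ∀ {A B} → A ∈F F → B ∈F G → DensePrefix (suc r) A B
shifted-cross⇒densePrefix {r = r} sF sG cr {A} {B} A∈F B∈G =
  Sum.[ ⊥-elim ∘′ shifted-cross⇒¬prefixBounded sF sG cr A∈F B∈G , id ]′ (prefixBounded⊎dense r A B)

-- Covering by hat families

length-cartesianProduct : ∀ {a b} {X : Set a} {Y : Set b} (xs : List X) (ys : List Y) →
                          length (cartesianProduct xs ys) ≡ length xs * length ys
length-cartesianProduct []       ys = refl
length-cartesianProduct (x ∷ xs) ys = begin
  length (map (x ,_) ys ++ cartesianProduct xs ys)
    ≡⟨ length-++ (map (x ,_) ys) ⟩
  length (map (x ,_) ys) + length (cartesianProduct xs ys)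
    ≡⟨ cong₂ _+_ (length-map (x ,_) ys) (length-cartesianProduct xs ys) ⟩
  length ys + length xs * length ys ∎
  where open ≡-Reasoning

∈-applyUpTo-suc : ∀ {n s} → 1 ≤ s → s ≤ n → s ∈ applyUpTo suc n
∈-applyUpTo-suc {s = suc s} _ s<n = ∈-applyUpTo⁺ suc s<n

∈hatFamily⁻ : ∀ {n} m s u (A : Subset n) → A ∈F hatFamily n m s u → ∣ A ∣ ≡ m × u ≤ prefix s A
∈hatFamily⁻ m s u A A∈ with Equivalence.to T-∧ (Equivalence.from T-≡ A∈)
... | ∣A∣≡m , u≤prefix = ≡ᵇ⇒≡ ∣ A ∣ m ∣A∣≡m , ≤ᵇ⇒≤ u (prefix s A) u≤prefix

∈hatFamily⁺ : ∀ {n} m s u (A : Subset n) → ∣ A ∣ ≡ m → u ≤ prefix s A → A ∈F hatFamily n m s u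
∈hatFamily⁺ m s u A ∣A∣≡m u≤prefix =
  Equivalence.to T-≡ (Equivalence.from T-∧ (≡⇒≡ᵇ ∣ A ∣ m ∣A∣≡m , ≤⇒≤ᵇ u≤prefix))

hatFamily-uniform : ∀ n m s u → Uniform m (hatFamily n m s u)
hatFamily-uniform n m s u A A∈ = proj₁ (∈hatFamily⁻ m s u A A∈)

hatFamily-cross : ∀ {n t} a b s u v → u + v ≡ s + t →
                  CrossIntersecting t (hatFamily n a s u) (hatFamily n b s v)
hatFamily-cross {t = t} a b s u v u+v≡s+t A B A∈ B∈ = +-cancelˡ-≤ s t ∣ A ∩ B ∣ (begin
  s + t                   ≡⟨ u+v≡s+t ⟨
  u + v                   ≤⟨ +-mono-≤ (proj₂ (∈hatFamily⁻ a s u A A∈)) (proj₂ (∈hatFamily⁻ b s v B B∈)) ⟩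
  prefix s A + prefix s B ≤⟨ prefix-+≤ s A B ⟩
  s + ∣ A ∩ B ∣           ∎)
  where open ≤-Reasoning

module _ {c ℓ} (V : OrderedValues c ℓ) where

  open OrderedValues V using (Carrier; Σ[_]; _·_)
    renaming ( _≤_ to _≼_; _+_ to _⊕_; ≤-refl to ≼-refl; ≤-trans to ≼-trans
             ; +-comm to ⊕-comm; +-monoˡ-≤ to ⊕-monoˡ-≼ )

  ≼-preorder : Preorder c c ℓ
  ≼-preorder = record
    { Carrier = Carrier ; _≈_ = _≡_ ; _≲_ = _≼_
    ; isPreorder = record
      { isEquivalence = isEquivalence ; reflexive = λ { refl → ≼-refl } ; trans = ≼-trans } }

  ⊕-mono-≼ : ∀ {x x′ y y′} → x ≼ x′ → y ≼ y′ → x ⊕ y ≼ x′ ⊕ y′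
  ⊕-mono-≼ {x} {x′} {y} {y′} x≼x′ y≼y′ =
    ≼-trans (⊕-monoˡ-≼ y x≼x′) (subst₂ _≼_ (⊕-comm y x′) (⊕-comm y′ x′) (⊕-monoˡ-≼ x′ y≼y′))

  Σ-map-≼ : ∀ {a} {X : Set a} (f : X → Carrier) {z} → (∀ x → f x ≼ z) →
            ∀ xs → Σ[ map f xs ] ≼ length xs · z
  Σ-map-≼ f f≼z []       = ≼-refl
  Σ-map-≼ f f≼z (x ∷ xs) = ⊕-mono-≼ (f≼z x) (Σ-map-≼ f f≼z xs)

  triple? : ∀ n t u v s → Dec (Triple V n t u v s)
  triple? n t u v s = ((1 ≤? u) ×-dec (u ≤? n)) ×-dec ((1 ≤? v) ×-dec (v ≤? n))
                  ×-dec ((1 ≤? s) ×-dec (s ≤? n)) ×-dec (u + v ≟ s + t)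

  hatFamily-admissible : ∀ {n a b t u v s} → Triple V n t u v s →
                         Admissible V a b t (hatFamily n a s u) (hatFamily n b s v)
  hatFamily-admissible {n} {a} {b} {u = u} {v} {s} (_ , _ , _ , u+v≡s+t) =
    hatFamily-uniform n a s u , hatFamily-uniform n b s v , hatFamily-cross a b s u v u+v≡s+t

  densePrefix⇒triple : ∀ {n t} (A B : Subset n) → 1 ≤ t → ∀ s → 1 ≤ s → s ≤ n →
    s + t ≤ prefix s A + prefix s B →
    Triple V n t (s + t ∸ prefix s B) (prefix s B) s × s + t ∸ prefix s B ≤ prefix s A
  densePrefix⇒triple {n} {t} A B 1≤t s 1≤s s≤n dense =
    ( (≤-trans 1≤t t≤u , ≤-trans u≤pA (≤-trans (prefix≤ s A) s≤n))
    , (≤-trans 1≤t t≤v , ≤-trans (prefix≤ s B) s≤n)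
    , (1≤s , s≤n)
    , m∸n+n≡m (≤-trans (prefix≤ s B) (m≤m+n s t)) )
    , u≤pA
    where
    u≤pA : s + t ∸ prefix s B ≤ prefix s A
    u≤pA = m≤n+o⇒m∸n≤o (s + t) (prefix s B) (subst (s + t ≤_) (+-comm (prefix s A) (prefix s B)) dense)
    t≤u : t ≤ s + t ∸ prefix s B
    t≤u = ≤-trans (≤-reflexive (sym (m+n∸m≡n s t))) (∸-monoʳ-≤ (s + t) (prefix≤ s B))
    t≤v : t ≤ prefix s B
    t≤v = +-cancelˡ-≤ s t (prefix s B) (≤-trans dense (+-monoˡ-≤ (prefix s B) (prefix≤ s A)))

  module HatCells (n a b t : ℕ) {u₀ v₀ s₀ : ℕ} (τ₀ : Triple V n t u₀ v₀ s₀) where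

    -- Cells (s, v) whose triple is invalid are filled with the valid triple
    -- (u₀, v₀, s₀), so that there are exactly n² cells; values may be negative,
    -- so they could not simply be dropped from the bound n² · N̂.
    hatCell : ℕ × ℕ → Family n × Family n
    hatCell (s , v) with triple? n t (s + t ∸ v) v s
    ... | yes _ = hatFamily n a s (s + t ∸ v) , hatFamily n b s v
    ... | no  _ = hatFamily n a s₀ u₀ , hatFamily n b s₀ v₀

    hatCell-valid : ∀ p → ∃[ u ] ∃[ v ] ∃[ s ]
                    Triple V n t u v s × hatCell p ≡ (hatFamily n a s u , hatFamily n b s v)
    hatCell-valid (s , v) with triple? n t (s + t ∸ v) v s
    ... | yes τ = _ , _ , _ , τ , refl
    ... | no  _ = _ , _ , _ , τ₀ , refl

    hatCell-∈ : ∀ {s v} → Triple V n t (s + t ∸ v) v s → ∀ {A B} →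
                A ∈F hatFamily n a s (s + t ∸ v) → B ∈F hatFamily n b s v →
                A ∈F proj₁ (hatCell (s , v)) × B ∈F proj₂ (hatCell (s , v))
    hatCell-∈ {s} {v} τ A∈ B∈ with triple? n t (s + t ∸ v) v s
    ... | yes _ = A∈ , B∈
    ... | no ¬τ = ⊥-elim (¬τ τ)

    cellIndices : List (ℕ × ℕ)
    cellIndices = cartesianProduct (applyUpTo suc n) (applyUpTo suc n)

    hatCells : List (Family n × Family n)
    hatCells = map hatCell cellIndices

    hatCells-cover : ∀ {F G} → 1 ≤ t → Shifted F → Shifted G → Uniform a F → Uniform b G →
                     CrossIntersecting t F G → Covers V F G hatCells
    hatCells-cover 1≤t@(s≤s z≤n) sF sG uF uG cr A B A∈F B∈G
      with shifted-cross⇒densePrefix sF sG cr A∈F B∈G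
    ... | s , 1≤s , s≤n , dense with densePrefix⇒triple A B 1≤t s 1≤s s≤n dense
    ... | τ@(_ , (1≤v , v≤n) , _) , u≤prefix = Any.map⁺ (lose
      (∈-cartesianProduct⁺ (∈-applyUpTo-suc 1≤s s≤n) (∈-applyUpTo-suc 1≤v v≤n))
      (hatCell-∈ τ (∈hatFamily⁺ a s _ A (uF A A∈F) u≤prefix) (∈hatFamily⁺ b s _ B (uG B B∈G) ≤-refl)))

    hatCells-Σ≼ : (h : Functional V n) {N̂ : Carrier} →
                  (∀ u v s → Triple V n t u v s → hatValue V n h a b u v s ≼ N̂) →
                  Σ[ map (λ (F , G) → h F G) hatCells ] ≼ (n * n) · N̂
    hatCells-Σ≼ h {N̂} N̂-max = subst₂ _≼_
      (cong Σ[_] (map-∘ cellIndices))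
      (cong (_· N̂) (trans (length-cartesianProduct (applyUpTo suc n) _)
                          (cong₂ _*_ (length-applyUpTo suc n) (length-applyUpTo suc n))))
      (Σ-map-≼ _ cell≼N̂ cellIndices)
      where
      cell≼N̂ : ∀ p → h (proj₁ (hatCell p)) (proj₂ (hatCell p)) ≼ N̂
      cell≼N̂ p with hatCell-valid p
      ... | u , v , s , τ , eq rewrite eq = N̂-max u v s τ

corollary1 : ∀ {c ℓ} (V : OrderedValues c ℓ) (n a b t : ℕ) → 1 ≤ n → 1 ≤ t →
    (h : Functional V n) → Symmetric V h → SuperAdditive V h →
    (N N̂ : OrderedValues.Carrier V) → IsN V n h a b t N → IsN̂ V n h a b t N̂ →
    OrderedValues._≤_ V N̂ N × OrderedValues._≤_ V N (OrderedValues._·_ V (n * n) N̂)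
corollary1 V n a b t _ 1≤t h symmetric superAdditive N N̂
  ((F₀ , G₀ , (uF₀ , uG₀ , cr₀) , hF₀G₀≡N) , N-max) ((u₀ , v₀ , s₀ , τ₀ , ĥ≡N̂) , N̂-max) =
  subst (λ x → OrderedValues._≤_ V x N) ĥ≡N̂ (N-max _ _ (hatFamily-admissible V τ₀)) ,
  (begin
    N        ≡⟨ hF₀G₀≡N ⟨
    h F₀ G₀  ≡⟨ symmetric F₀ G₀ F′ G′ card-F′ card-G′ ⟩
    h F′ G′  ≲⟨ superAdditive F′ G′ hatCells
                  (hatCells-cover 1≤t shifted-F′ shifted-G′ uniform-F′ uniform-G′ cross) ⟩
    _        ≲⟨ hatCells-Σ≼ h N̂-max ⟩
    (n * n) · N̂ ∎)
  where
  open OrderedValues V using (_·_)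
  open PreorderReasoning (≼-preorder V)
  open HatCells V n a b t τ₀
  open ShiftedCopy (shiftedCopy F₀ G₀ uF₀ uG₀ cr₀)
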